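{- Let $\lambda/\mu$ be a skew shape, satisfying that the inner (north-west) boundary of $\lambda/\mu$ contains the entire outer (south-east) boundary of $\mu$, all of whose rows have length one or two, and suppose $\lambda_i-\mu_i=2$ for some index $i$. Then the number of standard Young tableaux of shape $\lambda/\mu$ whose reading words avoid $123$ equals the number of standard Young tableaux whose reading words avoid $123$ of each of the following shapes: (a) $\langle\lambda_1+1,\dots,\lambda_i+1,\lambda_{i+1},\lambda_{i+2},\dots\rangle/\langle\mu_1+1,\dots,\mu_i+1,\mu_{i+1},\mu_{i+2},\dots\rangle$; (b) $\langle\lambda_1+1,\dots,\lambda_{i-1}+1,\lambda_i,\lambda_{i+1},\dots\rangle/\langle\mu_1+1,\dots,\mu_{i-1}+1,\mu_i,\mu_{i+1},\dots\rangle$.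
   Context: Young diagrams are drawn in English notation; the length of row $j$ of $\lambda/\mu$ is $\lambda_j-\mu_j$. A standard Young tableau of skew shape $\lambda/\mu$ with $N$ boxes is a filling of the boxes with $1,\dots,N$, each once, increasing along rows and down columns. The reading word of a tableau is obtained by reading rows left to right, starting with the bottom row and proceeding upward. A word avoids $123$ if it has no increasing subsequence of length $3$. -}

module Defs where

open import Data.Nat using (ℕ; zero; suc; _+_; _∸_; _≤_; _<_; _<?_)
open import Data.Fin using (Fin; toℕ)
open import Data.Vec using (Vec; lookup; toList; tabulate)
open import Data.List using (List; []; _∷_; length; concat; reverse; filter; map; upTo)
open import Data.Nat.ListAction using (sum)
open import Data.List.Membership.Propositional using (_∈_)
open import Data.List.Relation.Unary.Unique.Propositional using (Unique)
open import Data.List.Relation.Binary.Permutation.Propositional using (_↭_)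
open import Data.Product using (Σ; _×_; ∃; ∃-syntax)
open import Data.Empty using (⊥)
open import Relation.Binary.PropositionalEquality using (_≡_)
open import Relation.Nullary using (¬_)
open import Function.Bundles using (_⇔_)
open import Data.Bool using (if_then_else_)
open import Relation.Nullary.Decidable using (⌊_⌋)

-- A (skew) shape with n rows is given by two vectors lam, mu : Vec ℕ n
-- (row r = 0,1,...,n-1, i.e. 0-based row indices; paper's row r+1).
-- Columns are 0-based as well: box (r , c) belongs to lam/mu iff
-- mu_r ≤ c < lam_r.

IsPartition : ∀ {n} → Vec ℕ n → Set
IsPartition {n} v = (i j : Fin n) → toℕ i ≤ toℕ j → lookup v j ≤ lookup v i

InShape : ∀ {n} → Vec ℕ n → Vec ℕ n → Fin n → ℕ → Set
InShape lam mu r c = lookup mu r ≤ c × c < lookup lam r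

colLen : ∀ {n} → Vec ℕ n → ℕ → ℕ
colLen v c = length (filter (λ x → c <? x) (toList v))

-- The inner (north-west) boundary of lam/mu contains the entire outer
-- (south-east) boundary of mu:
--  * each vertical unit step of mu's boundary (right end of a nonempty
--    row r of mu) is adjacent to a box of lam/mu, i.e. mu_r < lam_r;
--  * each horizontal unit step of mu's boundary (bottom of a nonempty
--    column c of mu) is adjacent to a box of lam/mu, i.e. mu'_c < lam'_c.
InnerBoundaryContainsOuterBoundary : ∀ {n} → Vec ℕ n → Vec ℕ n → Set
InnerBoundaryContainsOuterBoundary {n} lam mu =
  ((r : Fin n) → 0 < lookup mu r → lookup mu r < lookup lam r)
  × ((c : ℕ) → (∃[ r ] c < lookup mu r) → colLen mu c < colLen lam c)

-- Fillings / tableaux.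
-- A filling of lam/mu is given by its rows: row r is the list of entries
-- of boxes (r , mu_r), (r , mu_r + 1), ..., (r , lam_r - 1), left to right.
Filling : ℕ → Set
Filling n = Vec (List ℕ) n

-- k-th element of a list (0 if out of range; only used in range)
at : List ℕ → ℕ → ℕ
at [] k = 0
at (x ∷ xs) zero = x
at (x ∷ xs) (suc k) = at xs k

entry : ∀ {n} → Vec ℕ n → Filling n → Fin n → ℕ → ℕ
entry mu T r c = at (lookup T r) (c ∸ lookup mu r)

size : ∀ {n} → Vec ℕ n → Vec ℕ n → ℕ
size {n} lam mu = sum (toList (tabulate {n = n} (λ r → lookup lam r ∸ lookup mu r)))

IsSYT : ∀ {n} → Vec ℕ n → Vec ℕ n → Filling n → Set
IsSYT {n} lam mu T =
  ((r : Fin n) → length (lookup T r) ≡ lookup lam r ∸ lookup mu r)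
  × (concat (toList T) ↭ map suc (upTo (size lam mu)))
  × ((r : Fin n) (c c' : ℕ) → c < c' → InShape lam mu r c → InShape lam mu r c' →
       entry mu T r c < entry mu T r c')
  × ((r r' : Fin n) (c : ℕ) → toℕ r < toℕ r' → InShape lam mu r c → InShape lam mu r' c →
       entry mu T r c < entry mu T r' c)

readingWord : ∀ {n} → Filling n → List ℕ
readingWord T = concat (reverse (toList T))

Avoids123 : List ℕ → Set
Avoids123 w = ¬ (Σ ℕ λ i → Σ ℕ λ j → Σ ℕ λ k →
  i < j × j < k × k < length w × at w i < at w j × at w j < at w k)

SYT123 : ∀ {n} → Vec ℕ n → Vec ℕ n → Filling n → Set
SYT123 lam mu T = IsSYT lam mu T × Avoids123 (readingWord T)

HasCard : {A : Set} → (A → Set) → ℕ → Set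
HasCard {A} P k = Σ (List A) λ L → length L ≡ k × Unique L × ((x : A) → (x ∈ L ⇔ P x))

NumSYT123 : ∀ {n} → Vec ℕ n → Vec ℕ n → ℕ → Set
NumSYT123 lam mu k = HasCard (SYT123 lam mu) k

bump : ∀ {n} → ℕ → Vec ℕ n → Vec ℕ n
bump k v = tabulate (λ r → if ⌊ toℕ r <? k ⌋ then suc (lookup v r) else lookup v r)

-- The bijection is the identity on row contents.  Shifting a block of
-- initial rows keeps every row length, so a filling T has the same rows,
-- the same set of entries and the same reading word for both shapes; only
-- the column condition changes, and only for pairs of rows on opposite
-- sides of the boundary between row s-1 and row s.
--  * Old shape ⇒ new shape: after the shift, a cell of a row above the
--    boundary sits over a cell that was to the right of the cell it used to
--    sit over, so the new condition follows from the old one and the rows.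
--  * New shape ⇒ old shape: by convexity of skew shapes a column meeting
--    rows r < s ≤ r' also meets rows s-1 and s, so it suffices to order
--    these two cells; a violation would create a 123 pattern in the reading
--    word, using that one of the two rows has length two.
module Submission where

open import Defs
open import Data.Nat using (ℕ; zero; suc; _+_; _∸_; _≤_; _<_; z≤n; s≤s; _<?_)
open import Data.Nat.Properties
open import Data.Fin using (Fin; toℕ; fromℕ<) renaming (zero to fzero; suc to fsuc)
open import Data.Fin.Properties using (toℕ-injective; toℕ<n; toℕ-fromℕ<)
open import Data.Vec using (Vec; []; lookup; toList; _∷_)
open import Data.Vec.Properties using (lookup∘tabulate; tabulate-cong)
open import Data.List using (List; []; _∷_; length; concat; reverse; _++_; map; upTo; [_])
open import Data.List.Properties using (unfold-reverse; concat-++; length-++; ++-identityʳ)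
open import Data.List.Membership.Propositional using (_∈_)
open import Data.List.Relation.Unary.Any using (here; there)
open import Data.List.Relation.Unary.All as All using ()
open import Data.List.Relation.Unary.AllPairs using (_∷_)
open import Data.List.Relation.Unary.Unique.Propositional using (Unique)
open import Data.List.Relation.Unary.Unique.Propositional.Properties using (map⁺; upTo⁺)
open import Data.List.Relation.Binary.Permutation.Propositional
  using (_↭_; ↭-refl; ↭-sym; ↭-trans; ↭⇒↭ₛ)
open import Data.List.Relation.Binary.Permutation.Propositional.Properties using (++-comm; ++⁺ˡ)
import Data.List.Relation.Binary.Permutation.Setoid.Properties as PermSetoid
open import Data.Nat.ListAction using (sum)
open import Data.Product using (Σ; _×_; _,_; proj₁; proj₂)
open import Data.Sum using (_⊎_; inj₁; inj₂)
open import Data.Empty using (⊥; ⊥-elim)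
open import Data.Bool using (if_then_else_)
open import Relation.Nullary using (yes; no)
open import Relation.Nullary.Decidable using (⌊_⌋)
open import Relation.Binary.Definitions using (tri<; tri≈; tri>)
open import Relation.Binary.PropositionalEquality
  using (_≡_; _≢_; refl; sym; trans; cong; subst; subst₂; setoid; module ≡-Reasoning)
open import Function.Bundles using (_⇔_; mk⇔; Equivalence)

HasCard-resp-⇔ : {A : Set} {P Q : A → Set} {k : ℕ} →
  (∀ x → P x ⇔ Q x) → HasCard P k → HasCard Q k
HasCard-resp-⇔ P⇔Q (xs , len , uniq , ∈⇔P) = xs , len , uniq , λ x →
  mk⇔ (λ x∈ → Equivalence.to (P⇔Q x) (Equivalence.to (∈⇔P x) x∈))
      (λ Qx → Equivalence.from (∈⇔P x) (Equivalence.from (P⇔Q x) Qx))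

at-++ˡ : ∀ (xs ys : List ℕ) i → i < length xs → at (xs ++ ys) i ≡ at xs i
at-++ˡ (x ∷ xs) ys zero    _         = refl
at-++ˡ (x ∷ xs) ys (suc i) (s≤s i<) = at-++ˡ xs ys i i<

at-++ʳ : ∀ (xs ys : List ℕ) j → at (xs ++ ys) (length xs + j) ≡ at ys j
at-++ʳ []       ys j = refl
at-++ʳ (x ∷ xs) ys j = at-++ʳ xs ys j

at-∈ : ∀ (xs : List ℕ) k → k < length xs → at xs k ∈ xs
at-∈ (x ∷ xs) zero    _         = here refl
at-∈ (x ∷ xs) (suc k) (s≤s k<) = there (at-∈ xs k k<)

at-injective : ∀ (w : List ℕ) → Unique w → ∀ {P P'} → P < P' → P' < length w → at w P ≢ at w P'
at-injective (x ∷ w) (x∉ ∷ _) {zero}  {suc P'} _         (s≤s P'<) = All.lookup x∉ (at-∈ w P' P'<)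
at-injective (x ∷ w) (_ ∷ u)  {suc P} {suc P'} (s≤s P<) (s≤s P'<) = at-injective w u P< P'<

unique-resp-↭ : ∀ {xs ys : List ℕ} → xs ↭ ys → Unique xs → Unique ys
unique-resp-↭ p = PermSetoid.Unique-resp-↭ (setoid ℕ) (↭⇒↭ₛ p)

readingWord-∷ : ∀ {n} (t : List ℕ) (T : Filling n) → readingWord (t ∷ T) ≡ readingWord T ++ t
readingWord-∷ t T = begin
    concat (reverse (t ∷ toList T))       ≡⟨ cong concat (unfold-reverse t (toList T)) ⟩
    concat (reverse (toList T) ++ [ t ])  ≡⟨ sym (concat-++ (reverse (toList T)) [ t ]) ⟩
    readingWord T ++ (t ++ [])            ≡⟨ cong (readingWord T ++_) (++-identityʳ t) ⟩
    readingWord T ++ t                    ∎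
  where open ≡-Reasoning

readingWord-↭ : ∀ {n} (T : Filling n) → readingWord T ↭ concat (toList T)
readingWord-↭ [] = ↭-refl
readingWord-↭ (t ∷ T) rewrite readingWord-∷ t T =
  ↭-trans (++-comm (readingWord T) t) (++⁺ˡ t (readingWord-↭ T))

readingWord-unique : ∀ {n} (T : Filling n) N →
  concat (toList T) ↭ map suc (upTo N) → Unique (readingWord T)
readingWord-unique T N p =
  unique-resp-↭ (↭-sym (↭-trans (readingWord-↭ T) p)) (map⁺ suc-injective (upTo⁺ N))

rowStart : ∀ {n} → Filling n → Fin n → ℕ
rowStart (t ∷ T) fzero    = length (readingWord T)
rowStart (t ∷ T) (fsuc r) = rowStart T r

rowLen : ∀ {n} → Filling n → Fin n → ℕ
rowLen T r = length (lookup T r)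

val : ∀ {n} → Filling n → Fin n → ℕ → ℕ
val T r j = at (lookup T r) j

rowStart-bound : ∀ {n} (T : Filling n) r {j} → j < rowLen T r →
  rowStart T r + j < length (readingWord T)
rowStart-bound (t ∷ T) fzero j< rewrite readingWord-∷ t T | length-++ (readingWord T) {t} =
  +-monoʳ-< (length (readingWord T)) j<
rowStart-bound (t ∷ T) (fsuc r) j< rewrite readingWord-∷ t T | length-++ (readingWord T) {t} =
  <-≤-trans (rowStart-bound T r j<) (m≤m+n _ _)

at-rowStart : ∀ {n} (T : Filling n) r {j} → j < rowLen T r →
  at (readingWord T) (rowStart T r + j) ≡ val T r j
at-rowStart (t ∷ T) fzero    {j} _  rewrite readingWord-∷ t T = at-++ʳ (readingWord T) t j
at-rowStart (t ∷ T) (fsuc r)     j< rewrite readingWord-∷ t T =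
  trans (at-++ˡ (readingWord T) t _ (rowStart-bound T r j<)) (at-rowStart T r j<)

lower-row-first : ∀ {n} (T : Filling n) r r' {j j'} → toℕ r < toℕ r' → j' < rowLen T r' →
  rowStart T r' + j' < rowStart T r + j
lower-row-first (t ∷ T) fzero    (fsuc r') _         j'< = <-≤-trans (rowStart-bound T r' j'<) (m≤m+n _ _)
lower-row-first (t ∷ T) (fsuc r) (fsuc r') (s≤s r<r') j'< = lower-row-first T r r' r<r' j'<

no-increasing-cells : ∀ {n} (T : Filling n) → Avoids123 (readingWord T) →
  ∀ {r₁ r₂ r₃ j₁ j₂ j₃} →
  rowStart T r₁ + j₁ < rowStart T r₂ + j₂ → rowStart T r₂ + j₂ < rowStart T r₃ + j₃ →
  j₁ < rowLen T r₁ → j₂ < rowLen T r₂ → j₃ < rowLen T r₃ →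
  val T r₁ j₁ < val T r₂ j₂ → val T r₂ j₂ < val T r₃ j₃ → ⊥
no-increasing-cells T avoids {r₁} {r₂} {r₃} P₁<P₂ P₂<P₃ j₁< j₂< j₃< v₁<v₂ v₂<v₃ =
  avoids (_ , _ , _ , P₁<P₂ , P₂<P₃ , rowStart-bound T r₃ j₃<
         , subst₂ _<_ (sym (at-rowStart T r₁ j₁<)) (sym (at-rowStart T r₂ j₂<)) v₁<v₂
         , subst₂ _<_ (sym (at-rowStart T r₂ j₂<)) (sym (at-rowStart T r₃ j₃<)) v₂<v₃)

-- Conditions on a filling in row/offset coordinates; the cell at offset j of
-- row r lies in column mu_r + j.
module _ {n : ℕ} (T : Filling n) where

  RowIncreasing : Set
  RowIncreasing = ∀ r {j j'} → j < j' → j' < rowLen T r → val T r j < val T r j'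

  ColumnIncreasing : Vec ℕ n → Set
  ColumnIncreasing mu = ∀ r r' {j j'} → toℕ r < toℕ r' → j < rowLen T r → j' < rowLen T r' →
    lookup mu r + j ≡ lookup mu r' + j' → val T r j < val T r' j'

column-order-from-avoidance : ∀ {n} (T : Filling n) (mu : Vec ℕ n) →
  RowIncreasing T → Avoids123 (readingWord T) → Unique (readingWord T) →
  ∀ {p q jp jq} → toℕ p < toℕ q → jp < rowLen T p → jq < rowLen T q →
  lookup mu p + jp ≡ lookup mu q + jq → lookup mu q ≤ lookup mu p →
  (lookup mu p ≡ lookup mu q → 1 < rowLen T p) → val T p jp < val T q jq
column-order-from-avoidance T mu rows avoids unique {p} {q} {jp} {jq} p<q jp< jq< sameCol mq≤mp long
  with <-cmp (val T p jp) (val T q jq)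
... | tri< ordered _ _ = ordered
... | tri≈ _ equal _ = ⊥-elim (at-injective (readingWord T) unique
        (lower-row-first T p q p<q jq<) (rowStart-bound T p jp<)
        (trans (at-rowStart T q jq<) (trans (sym equal) (sym (at-rowStart T p jp<)))))
... | tri> _ _ inverted = ⊥-elim (triple jp jq jp< jq< sameCol inverted)
  where
  -- q's cell is preceded in its row by a smaller one: pattern (q,k) (q,k+1) (p,jp);
  -- q's cell starts its row: then so does p's, and (q,0) (p,0) (p,1) is a pattern
  triple : ∀ jp jq → jp < rowLen T p → jq < rowLen T q → lookup mu p + jp ≡ lookup mu q + jq →
    val T q jq < val T p jp → ⊥
  triple jp (suc k) jp< k+1< _ inv = no-increasing-cells T avoids
    (+-monoʳ-< (rowStart T q) (n<1+n k)) (lower-row-first T p q p<q k+1<)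
    (<-trans (n<1+n k) k+1<) k+1< jp< (rows q (n<1+n k) k+1<) inv
  triple (suc m) zero _ _ eq _ =
    <⇒≱ (<-≤-trans (m<m+n (lookup mu p) (s≤s z≤n)) (≤-reflexive (trans eq (+-identityʳ _)))) mq≤mp
  triple zero zero 0<p 0<q eq inv = no-increasing-cells T avoids
    (lower-row-first T p q p<q 0<q) (+-monoʳ-< (rowStart T p) (s≤s z≤n))
    0<q 0<p 1<p inv (rows p (s≤s z≤n) 1<p)
    where
    1<p : 1 < rowLen T p
    1<p = long (trans (sym (+-identityʳ _)) (trans eq (+-identityʳ _)))

record ShiftedBy {n : ℕ} (s : ℕ) (v v' : Vec ℕ n) : Set where
  field
    below : (r : Fin n) → toℕ r < s → lookup v' r ≡ suc (lookup v r)
    above : (r : Fin n) → s ≤ toℕ r → lookup v' r ≡ lookup v r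
open ShiftedBy

bump-shifted : ∀ {n} s (v : Vec ℕ n) → ShiftedBy s v (bump s v)
bump-shifted s v = record { below = below′ ; above = above′ }
  where
  bumped : ∀ r → lookup (bump s v) r ≡ (if ⌊ toℕ r <? s ⌋ then suc (lookup v r) else lookup v r)
  bumped = lookup∘tabulate (λ r → if ⌊ toℕ r <? s ⌋ then suc (lookup v r) else lookup v r)
  below′ : ∀ r → toℕ r < s → lookup (bump s v) r ≡ suc (lookup v r)
  below′ r r<s rewrite bumped r with toℕ r <? s
  ... | yes _   = refl
  ... | no r≮s = ⊥-elim (r≮s r<s)
  above′ : ∀ r → s ≤ toℕ r → lookup (bump s v) r ≡ lookup v r
  above′ r s≤r rewrite bumped r with toℕ r <? s
  ... | yes r<s = ⊥-elim (<⇒≱ r<s s≤r)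
  ... | no _    = refl

Side : ℕ → ℕ → ℕ → Set
Side s a b = (b < s ⊎ s ≤ a) ⊎ (a < s × s ≤ b)

side : ∀ s a b → Side s a b
side s a b with b <? s | a <? s
... | yes b<s | _       = inj₁ (inj₁ b<s)
... | no _    | no a≮s  = inj₁ (inj₂ (≮⇒≥ a≮s))
... | no b≮s  | yes a<s = inj₂ (a<s , ≮⇒≥ b≮s)

same-side-shift : ∀ {n s} {v v' : Vec ℕ n} → ShiftedBy s v v' → ∀ {r r' j j'} →
  toℕ r ≤ toℕ r' → toℕ r' < s ⊎ s ≤ toℕ r →
  lookup v r + j ≡ lookup v r' + j' → lookup v' r + j ≡ lookup v' r' + j'
same-side-shift shift r≤r' (inj₁ r'<s) eq
  rewrite below shift _ (≤-<-trans r≤r' r'<s) | below shift _ r'<s = cong suc eq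
same-side-shift shift r≤r' (inj₂ s≤r) eq
  rewrite above shift _ s≤r | above shift _ (≤-trans s≤r r≤r') = eq

same-side-unshift : ∀ {n s} {v v' : Vec ℕ n} → ShiftedBy s v v' → ∀ {r r' j j'} →
  toℕ r ≤ toℕ r' → toℕ r' < s ⊎ s ≤ toℕ r →
  lookup v' r + j ≡ lookup v' r' + j' → lookup v r + j ≡ lookup v r' + j'
same-side-unshift shift r≤r' (inj₁ r'<s) eq
  rewrite below shift _ (≤-<-trans r≤r' r'<s) | below shift _ r'<s = suc-injective eq
same-side-unshift shift r≤r' (inj₂ s≤r) eq
  rewrite above shift _ s≤r | above shift _ (≤-trans s≤r r≤r') = eq

-- Shifting the first s rows right preserves column-strictness: a cell of
-- a shifted row now sits over the right neighbour of the cell it used to sit over.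
columns-after-shift : ∀ {n s} (T : Filling n) {mu mu' : Vec ℕ n} → IsPartition mu →
  ShiftedBy s mu mu' → RowIncreasing T → ColumnIncreasing T mu → ColumnIncreasing T mu'
columns-after-shift {s = s} T {mu} {mu'} mu-part shift rows cols r r' {j} {j'} r<r' j< j'< eq
  with side s (toℕ r) (toℕ r')
... | inj₁ same = cols r r' r<r' j< j'< (same-side-unshift shift (<⇒≤ r<r') same eq)
... | inj₂ (r<s , s≤r') = step j' j'< eq'
  where
  eq' : suc (lookup mu r + j) ≡ lookup mu r' + j'
  eq' = trans (sym (cong (_+ j) (below shift r r<s))) (trans eq (cong (_+ j') (above shift r' s≤r')))
  step : ∀ j' → j' < rowLen T r' → suc (lookup mu r + j) ≡ lookup mu r' + j' → val T r j < val T r' j'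
  step zero    _   e = ⊥-elim (<-irrefl (sym (trans e (+-identityʳ _)))
                         (≤-<-trans (mu-part r r' (<⇒≤ r<r')) (s≤s (m≤m+n _ j))))
  step (suc k) k+1< e = <-trans (cols r r' r<r' j< (<-trans (n<1+n k) k+1<) (suc-injective (trans e (+-suc _ k))))
                                (rows r' (n<1+n k) k+1<)

column-between : ∀ {n} (T : Filling n) {lam mu : Vec ℕ n} →
  IsPartition lam → IsPartition mu → (∀ x → lookup lam x ≡ lookup mu x + rowLen T x) →
  ∀ {r r' x j j'} → toℕ r ≤ toℕ x → toℕ x ≤ toℕ r' → j' < rowLen T r' →
  lookup mu r + j ≡ lookup mu r' + j' →
  Σ ℕ λ k → k < rowLen T x × lookup mu x + k ≡ lookup mu r + j
column-between T {lam} {mu} lam-part mu-part fits {r} {r'} {x} {j} {j'} r≤x x≤r' j'< eq =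
  c ∸ lookup mu x , +-cancelˡ-< (lookup mu x) _ _ (subst (_< lookup mu x + rowLen T x) (sym start) c<) , start
  where
  c = lookup mu r + j
  start : lookup mu x + (c ∸ lookup mu x) ≡ c
  start = m+[n∸m]≡n (≤-trans (mu-part r x r≤x) (m≤m+n _ j))
  c< : c < lookup mu x + rowLen T x
  c< = subst (_< lookup mu x + rowLen T x) (sym eq)
         (<-≤-trans (+-monoʳ-< (lookup mu r') j'<) (subst₂ _≤_ (fits r') (fits x) (lam-part x r' x≤r')))

boundary-rows : ∀ {n} s (r r' : Fin n) → toℕ r < s → s ≤ toℕ r' →
  Σ (Fin n) λ p → Σ (Fin n) λ q → suc (toℕ p) ≡ s × toℕ q ≡ s
boundary-rows {n} (suc s₀) r r' _ s≤r' =
  fromℕ< (<-trans (n<1+n s₀) q<n) , fromℕ< q<n , cong suc (toℕ-fromℕ< _) , toℕ-fromℕ< _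
  where
  q<n : suc s₀ < n
  q<n = ≤-<-trans s≤r' (toℕ<n r')

columns-before-shift : ∀ {n s} (T : Filling n) {lam mu mu' : Vec ℕ n} →
  IsPartition lam → IsPartition mu → (∀ x → lookup lam x ≡ lookup mu x + rowLen T x) →
  ShiftedBy s mu mu' → RowIncreasing T → Avoids123 (readingWord T) → Unique (readingWord T) →
  (∀ p q → suc (toℕ p) ≡ s → toℕ q ≡ s → 1 < rowLen T p ⊎ 1 < rowLen T q) →
  ColumnIncreasing T mu' → ColumnIncreasing T mu
columns-before-shift {n} {s} T {lam} {mu} lam-part mu-part fits shift rows avoids unique boundary cols' =
  cols
  where
  -- within one side of the boundary the shifted condition is the original one
  weakly-ordered : ∀ r r' {j j'} → toℕ r ≤ toℕ r' → toℕ r' < s ⊎ s ≤ toℕ r →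
    j < rowLen T r → j' < rowLen T r' →
    lookup mu r + j ≡ lookup mu r' + j' → val T r j ≤ val T r' j'
  weakly-ordered r r' r≤r' same j< j'< eq with m≤n⇒m<n∨m≡n r≤r'
  ... | inj₁ r<r' = <⇒≤ (cols' r r' r<r' j< j'< (same-side-shift shift r≤r' same eq))
  ... | inj₂ r≡r' with toℕ-injective r≡r'
  ...   | refl = ≤-reflexive (cong (val T r) (+-cancelˡ-≡ (lookup mu r) _ _ eq))

  across : ∀ r r' {j j'} → toℕ r < s → s ≤ toℕ r' → j < rowLen T r → j' < rowLen T r' →
    lookup mu r + j ≡ lookup mu r' + j' → val T r j < val T r' j'
  across r r' {j} {j'} r<s s≤r' j< j'< eq with boundary-rows s r r' r<s s≤r'
  ... | p , q , refl , q≡s = ≤-<-trans below-p (<-≤-trans p-above-q above-r')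
    where
    p<q : toℕ p < toℕ q
    p<q = ≤-reflexive (sym q≡s)
    q≤r' : toℕ q ≤ toℕ r'
    q≤r' = subst (_≤ toℕ r') (sym q≡s) s≤r'
    r≤q : toℕ r ≤ toℕ q
    r≤q = <⇒≤ (subst (toℕ r <_) (sym q≡s) r<s)
    atP : Σ ℕ λ k → k < rowLen T p × lookup mu p + k ≡ lookup mu r + j
    atP = column-between T {lam} {mu} lam-part mu-part fits (≤-pred r<s) (≤-trans (<⇒≤ p<q) q≤r') j'< eq
    atQ : Σ ℕ λ k → k < rowLen T q × lookup mu q + k ≡ lookup mu r + j
    atQ = column-between T {lam} {mu} lam-part mu-part fits r≤q q≤r' j'< eq
    kp kq : ℕ
    kp = proj₁ atP
    kq = proj₁ atQ
    kp< : kp < rowLen T p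
    kp< = proj₁ (proj₂ atP)
    kq< : kq < rowLen T q
    kq< = proj₁ (proj₂ atQ)
    p-col : lookup mu p + kp ≡ lookup mu r + j
    p-col = proj₂ (proj₂ atP)
    q-col : lookup mu q + kq ≡ lookup mu r + j
    q-col = proj₂ (proj₂ atQ)
    -- if rows p and q start in the same column, row p is at least as long as row q
    long : lookup mu p ≡ lookup mu q → 1 < rowLen T p
    long mp≡mq with boundary p q refl q≡s
    ... | inj₁ p-long = p-long
    ... | inj₂ q-long = <-≤-trans q-long (+-cancelˡ-≤ (lookup mu q) _ _
            (subst₂ _≤_ (fits q) (trans (fits p) (cong (_+ rowLen T p) mp≡mq)) (lam-part p q (<⇒≤ p<q))))
    below-p : val T r j ≤ val T p kp
    below-p = weakly-ordered r p (≤-pred r<s) (inj₁ ≤-refl) j< kp< (sym p-col)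
    p-above-q : val T p kp < val T q kq
    p-above-q = column-order-from-avoidance T mu rows avoids unique p<q kp< kq<
                  (trans p-col (sym q-col)) (mu-part p q (<⇒≤ p<q)) long
    above-r' : val T q kq ≤ val T r' j'
    above-r' = weakly-ordered q r' q≤r' (inj₂ (≤-reflexive (sym q≡s))) kq< j'< (trans q-col eq)

  cols : ColumnIncreasing T mu
  cols r r' r<r' j< j'< eq with side s (toℕ r) (toℕ r')
  ... | inj₁ same         = cols' r r' r<r' j< j'< (same-side-shift shift (<⇒≤ r<r') same eq)
  ... | inj₂ (r<s , s≤r') = across r r' r<s s≤r' j< j'< eq

module BoxCoordinates {n : ℕ} (lam mu : Vec ℕ n) (T : Filling n)
  (mu≤lam : ∀ r → lookup mu r ≤ lookup lam r)
  (lengths : ∀ r → rowLen T r ≡ lookup lam r ∸ lookup mu r) where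

  RowCondition : Set
  RowCondition = (r : Fin n) (c c' : ℕ) → c < c' → InShape lam mu r c → InShape lam mu r c' →
    entry mu T r c < entry mu T r c'

  ColumnCondition : Set
  ColumnCondition = (r r' : Fin n) (c : ℕ) → toℕ r < toℕ r' → InShape lam mu r c → InShape lam mu r' c →
    entry mu T r c < entry mu T r' c

  fits : ∀ r → lookup lam r ≡ lookup mu r + rowLen T r
  fits r = trans (sym (m+[n∸m]≡n (mu≤lam r))) (cong (lookup mu r +_) (sym (lengths r)))

  cell-inShape : ∀ r {j} → j < rowLen T r → InShape lam mu r (lookup mu r + j)
  cell-inShape r {j} j< = m≤m+n _ j , subst (lookup mu r + j <_) (sym (fits r)) (+-monoʳ-< (lookup mu r) j<)

  entry-offset : ∀ r j → entry mu T r (lookup mu r + j) ≡ val T r j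
  entry-offset r j = cong (val T r) (m+n∸m≡n (lookup mu r) j)

  inShape-offset : ∀ r {c} → InShape lam mu r c → c ∸ lookup mu r < rowLen T r
  inShape-offset r {c} (mu≤c , c<lam) = subst (c ∸ lookup mu r <_) (sym (lengths r)) (∸-monoˡ-< c<lam mu≤c)

  rows-⇔ : RowCondition ⇔ RowIncreasing T
  rows-⇔ = mk⇔
    (λ rows r {j} {j'} j<j' j'< → subst₂ _<_ (entry-offset r j) (entry-offset r j')
       (rows r _ _ (+-monoʳ-< (lookup mu r) j<j') (cell-inShape r (<-trans j<j' j'<)) (cell-inShape r j'<)))
    (λ rows r c c' c<c' inC inC' → rows r (∸-monoˡ-< c<c' (proj₁ inC)) (inShape-offset r inC'))

  columns-⇔ : ColumnCondition ⇔ ColumnIncreasing T mu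
  columns-⇔ = mk⇔
    (λ cols r r' {j} {j'} r<r' j< j'< eq →
       subst₂ _<_ (entry-offset r j) (trans (cong (entry mu T r') eq) (entry-offset r' j'))
         (cols r r' _ r<r' (cell-inShape r j<) (subst (InShape lam mu r') (sym eq) (cell-inShape r' j'<))))
    (λ cols r r' c r<r' inC inC' → cols r r' r<r' (inShape-offset r inC) (inShape-offset r' inC')
       (trans (m+[n∸m]≡n (proj₁ inC)) (sym (m+[n∸m]≡n (proj₁ inC')))))

module ShiftInvariance {n : ℕ} (s : ℕ) {lam mu lam' mu' : Vec ℕ n}
  (lam-part : IsPartition lam) (mu-part : IsPartition mu)
  (mu≤lam : ∀ r → lookup mu r ≤ lookup lam r)
  (shift-lam : ShiftedBy s lam lam') (shift-mu : ShiftedBy s mu mu')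
  (boundary : ∀ p q → suc (toℕ p) ≡ s → toℕ q ≡ s →
    lookup lam p ≡ lookup mu p + 2 ⊎ lookup lam q ≡ lookup mu q + 2) where

  same-row-lengths : ∀ r → lookup lam' r ∸ lookup mu' r ≡ lookup lam r ∸ lookup mu r
  same-row-lengths r with toℕ r <? s
  ... | yes r<s rewrite below shift-lam r r<s | below shift-mu r r<s = refl
  ... | no r≮s  rewrite above shift-lam r (≮⇒≥ r≮s) | above shift-mu r (≮⇒≥ r≮s) = refl

  mu'≤lam' : ∀ r → lookup mu' r ≤ lookup lam' r
  mu'≤lam' r with toℕ r <? s
  ... | yes r<s rewrite below shift-lam r r<s | below shift-mu r r<s = s≤s (mu≤lam r)
  ... | no r≮s  rewrite above shift-lam r (≮⇒≥ r≮s) | above shift-mu r (≮⇒≥ r≮s) = mu≤lam r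

  same-size : size lam' mu' ≡ size lam mu
  same-size = cong (λ v → sum (toList v)) (tabulate-cong same-row-lengths)

  module _ (T : Filling n) (lengths : ∀ r → rowLen T r ≡ lookup lam r ∸ lookup mu r) where

    lengths' : ∀ r → rowLen T r ≡ lookup lam' r ∸ lookup mu' r
    lengths' r = trans (lengths r) (sym (same-row-lengths r))

    module Old = BoxCoordinates lam mu T mu≤lam lengths
    module New = BoxCoordinates lam' mu' T mu'≤lam' lengths'

    long-row : ∀ r → lookup lam r ≡ lookup mu r + 2 → 1 < rowLen T r
    long-row r two =
      subst (1 <_) (+-cancelˡ-≡ (lookup mu r) _ _ (trans (sym two) (Old.fits r))) (s≤s (s≤s z≤n))

    boundary-long : ∀ p q → suc (toℕ p) ≡ s → toℕ q ≡ s → 1 < rowLen T p ⊎ 1 < rowLen T q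
    boundary-long p q p+1≡s q≡s with boundary p q p+1≡s q≡s
    ... | inj₁ two = inj₁ (long-row p two)
    ... | inj₂ two = inj₂ (long-row q two)

    entries-resp : ∀ {N N'} → N ≡ N' →
      concat (toList T) ↭ map suc (upTo N) → concat (toList T) ↭ map suc (upTo N')
    entries-resp refl perm = perm

    to-shifted : SYT123 lam mu T → SYT123 lam' mu' T
    to-shifted ((_ , entries , rowsB , colsB) , avoids) =
      (lengths' , entries-resp (sym same-size) entries , Equivalence.from New.rows-⇔ rows ,
       Equivalence.from New.columns-⇔
         (columns-after-shift T mu-part shift-mu rows (Equivalence.to Old.columns-⇔ colsB)))
      , avoids
      where
      rows : RowIncreasing T
      rows = Equivalence.to Old.rows-⇔ rowsB

    from-shifted : SYT123 lam' mu' T → SYT123 lam mu T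
    from-shifted ((_ , entries , rowsB , colsB) , avoids) =
      (lengths , entries-resp same-size entries , Equivalence.from Old.rows-⇔ rows ,
       Equivalence.from Old.columns-⇔
         (columns-before-shift T {lam} lam-part mu-part Old.fits shift-mu rows avoids
            (readingWord-unique T _ entries) boundary-long (Equivalence.to New.columns-⇔ colsB)))
      , avoids
      where
      rows : RowIncreasing T
      rows = Equivalence.to New.rows-⇔ rowsB

  shift-⇔ : ∀ T → SYT123 lam mu T ⇔ SYT123 lam' mu' T
  shift-⇔ T = mk⇔ (λ syt → to-shifted T (proj₁ (proj₁ syt)) syt)
                  (λ syt → from-shifted T (λ r → trans (proj₁ (proj₁ syt) r) (same-row-lengths r)) syt)

-- Rows 0..i (shape (a)) and rows 0..i-1 (shape (b)) are shifted; in both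
-- cases row i, of length two, is adjacent to the boundary.
proposition7p8 : (n : ℕ) (lam mu : Vec ℕ n) →
    IsPartition lam → IsPartition mu →
    InnerBoundaryContainsOuterBoundary lam mu →
    ((r : Fin n) → (lookup lam r ≡ lookup mu r + 1) ⊎ (lookup lam r ≡ lookup mu r + 2)) →
    (i : Fin n) → lookup lam i ≡ lookup mu i + 2 →
    (k : ℕ) → NumSYT123 lam mu k →
    NumSYT123 (bump (suc (toℕ i)) lam) (bump (suc (toℕ i)) mu) k
    × NumSYT123 (bump (toℕ i) lam) (bump (toℕ i) mu) k
proposition7p8 n lam mu lam-part mu-part _ oneOrTwo i two k count =
  HasCard-resp-⇔ (ShiftInvariance.shift-⇔ (suc (toℕ i)) lam-part mu-part mu≤lam
                    (bump-shifted _ lam) (bump-shifted _ mu) domino-above) count ,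
  HasCard-resp-⇔ (ShiftInvariance.shift-⇔ (toℕ i) lam-part mu-part mu≤lam
                    (bump-shifted _ lam) (bump-shifted _ mu) domino-below) count
  where
  mu≤lam : ∀ r → lookup mu r ≤ lookup lam r
  mu≤lam r with oneOrTwo r
  ... | inj₁ one = subst (lookup mu r ≤_) (sym one) (m≤m+n _ 1)
  ... | inj₂ two = subst (lookup mu r ≤_) (sym two) (m≤m+n _ 2)
  domino-above : ∀ p q → suc (toℕ p) ≡ suc (toℕ i) → toℕ q ≡ suc (toℕ i) →
    lookup lam p ≡ lookup mu p + 2 ⊎ lookup lam q ≡ lookup mu q + 2
  domino-above p _ p+1≡i+1 _ rewrite toℕ-injective (suc-injective p+1≡i+1) = inj₁ two
  domino-below : ∀ p q → suc (toℕ p) ≡ toℕ i → toℕ q ≡ toℕ i →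
    lookup lam p ≡ lookup mu p + 2 ⊎ lookup lam q ≡ lookup mu q + 2
  domino-below _ q _ q≡i rewrite toℕ-injective q≡i = inj₂ two
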